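{- For every even positive integer $n$, there is a square-free circular word of length $n$ over the alphabet $V(D)$ that is walkable in the digraph $D$.
   Context: Let $\mathbb{S}_\Gamma$ be the six permutations of $\{\mathtt{a},\mathtt{b},\mathtt{c}\}$ written in cycle notation as formal symbols $()$, $(\mathtt{ab})$, $(\mathtt{ac})$, $(\mathtt{bc})$, $(\mathtt{abc})$, $(\mathtt{acb})$, and for each such $\pi$ let $\tilde\pi$ be another formal symbol; $\widetilde{\mathbb{S}}_\Gamma=\{\tilde\pi\}$. The digraph $D$ has vertex set $V(D)=\mathbb{S}_\Gamma\cup\widetilde{\mathbb{S}}_\Gamma$ (12 vertices) and exactly the 24 arcs: $()\to\widetilde{(\mathtt{ab})}$, $()\to(\mathtt{bc})$; $(\mathtt{ab})\to\widetilde{()}$, $(\mathtt{ab})\to(\mathtt{abc})$; $(\mathtt{ac})\to\widetilde{(\mathtt{abc})}$, $(\mathtt{ac})\to(\mathtt{acb})$; $(\mathtt{bc})\to\widetilde{(\mathtt{acb})}$, $(\mathtt{bc})\to()$; $(\mathtt{abc})\to\widetilde{(\mathtt{ac})}$, $(\mathtt{abc})\to(\mathtt{ab})$; $(\mathtt{acb})\to\widetilde{(\mathtt{bc})}$, $(\mathtt{acb})\to(\mathtt{ac})$; $\widetilde{()}\to(\mathtt{ac})$, $\widetilde{()}\to\widetilde{(\mathtt{bc})}$; $\widetilde{(\mathtt{ab})}\to(\mathtt{acb})$, $\widetilde{(\mathtt{ab})}\to\widetilde{(\mathtt{abc})}$; $\widetilde{(\mathtt{ac})}\to()$, $\widetilde{(\mathtt{ac})}\to\widetilde{(\mathtt{acb})}$;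 $\widetilde{(\mathtt{bc})}\to(\mathtt{abc})$, $\widetilde{(\mathtt{bc})}\to\widetilde{()}$; $\widetilde{(\mathtt{abc})}\to(\mathtt{bc})$, $\widetilde{(\mathtt{abc})}\to\widetilde{(\mathtt{ab})}$; $\widetilde{(\mathtt{acb})}\to(\mathtt{ab})$, $\widetilde{(\mathtt{acb})}\to\widetilde{(\mathtt{ac})}$. A word is square-free if it has no factor $xx$ with $x$ nonempty. The circular word $\langle w\rangle$ is the set of all conjugates (cyclic shifts) of $w$; it is square-free if every conjugate is square-free; its length is $|w|$. For $w=w_0\cdots w_{n-1}$ over $V(D)$, $\langle w\rangle$ is walkable in $D$ if there is an arc from $w_i$ to $w_{i+1}$ for every $i$, indices modulo $n$. -}

module Defs where

open import Data.Nat using (ℕ; _<_)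
open import Data.List using (List; []; _∷_; _++_; length; drop; take)
open import Data.Product using (Σ)
open import Relation.Binary.PropositionalEquality using (_≡_)
open import Relation.Nullary using (¬_)
open import Data.Unit using (⊤)
open import Data.List.Relation.Unary.Linked using (Linked)

-- Vertices of D: the six permutations (cycle notation, as formal symbols)
-- and their tilde-copies.
data V : Set where
  e ab ac bc abc acb : V
  e~ ab~ ac~ bc~ abc~ acb~ : V

data Arc : V → V → Set where
  a1  : Arc e ab~
  a2  : Arc e bc
  a3  : Arc ab e~
  a4  : Arc ab abc
  a5  : Arc ac abc~
  a6  : Arc ac acb
  a7  : Arc bc acb~
  a8  : Arc bc e
  a9  : Arc abc ac~
  a10 : Arc abc ab
  a11 : Arc acb bc~
  a12 : Arc acb ac
  a13 : Arc e~ ac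
  a14 : Arc e~ bc~
  a15 : Arc ab~ acb
  a16 : Arc ab~ abc~
  a17 : Arc ac~ e
  a18 : Arc ac~ acb~
  a19 : Arc bc~ abc
  a20 : Arc bc~ e~
  a21 : Arc abc~ bc
  a22 : Arc abc~ ab~
  a23 : Arc acb~ ab
  a24 : Arc acb~ ac~

HasSquare : {A : Set} → List A → Set
HasSquare {A} w =
  Σ (List A) λ u → Σ A λ a → Σ (List A) λ x → Σ (List A) λ v →
    w ≡ u ++ (a ∷ x) ++ (a ∷ x) ++ v

SquareFree : {A : Set} → List A → Set
SquareFree w = ¬ HasSquare w

rotate : {A : Set} → ℕ → List A → List A
rotate k w = drop k w ++ take k w

CircSquareFree : {A : Set} → List A → Set
CircSquareFree w = ∀ k → k < length w → SquareFree (rotate k w)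

-- ⟨w⟩ is walkable in D: arc from w_i to w_{i+1} for all i, indices mod n.
-- Equivalently stated for w = w0 ∷ ws: every consecutive pair of
-- w0 ∷ ws ++ [w0] is an arc (this lists exactly the pairs (w_i, w_{i+1 mod n})).
-- The empty word is taken to be walkable (vacuous); only n ≥ 2 is used.
Walkable : List V → Set
Walkable [] = ⊤
Walkable (w0 ∷ ws) = Linked Arc (w0 ∷ ws ++ w0 ∷ [])

-- The letters other than e and ab~ carry an 11-uniform morphism g that maps walks of D
-- to walks and preserves square-freeness of walks: a square of period at most 20 in
-- g(w) lies in the image of a factor of w of length at most 5 (checked exhaustively);
-- a square of period 11p pulls back, through the first letters of the blocks, to a
-- square of period p in w; any other period would place some block g(c) at a
-- non-trivial offset inside g(a)g(b) for an arc a → b, which never happens.  Iterating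
-- g on abc~ yields arbitrarily long square-free walks avoiding e and ab~.  In the
-- circular word ab~ P e T, with P a prefix of such a walk and T one of finitely many
-- connectors, ab~ and e occur once each, so every square lies inside P or inside T.
-- D is bipartite, so |P| is even and a connector of the right even length closes the
-- word.  Lengths up to 18 are covered by explicit words.

module Submission where

open import Defs
open import Data.Bool using (Bool; true; false; not; _∧_; _∨_; T)
open import Data.Bool.Properties using (T-∧; T-∨; not-involutive)
open import Data.Empty using (⊥-elim)
open import Data.Unit using (tt)
open import Data.List using (List; []; _∷_; _++_; length; drop; take; concatMap; head; last; upTo; filter; map)
open import Data.Bool.ListAction using (any)
open import Data.List.Properties using (filter-++; filter-none; filter-some; length-++; ++-assoc; ++-identityʳ; drop-[]; take-[]; length-take; length-drop; take++drop≡id; ≡-dec; ∷-injective)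
open import Data.List.Membership.Propositional using (_∈_)
open import Data.List.Membership.Propositional.Properties using (∈-filter⁺; ∈-concatMap⁺; ∈-map⁺)
open import Data.List.Relation.Unary.All as All using (All; []; _∷_)
import Data.List.Relation.Unary.All.Properties as All
open import Data.List.Relation.Unary.All.Properties using (¬Any⇒All¬)
open import Data.List.Relation.Unary.Any as Any using (Any; here; there)
import Data.List.Relation.Unary.Any.Properties as Any
open import Data.List.Relation.Unary.Linked using (Linked; []; [-]; _∷_; linked?; tail)
import Data.List.Relation.Unary.Linked.Properties as Linked
open import Data.Maybe using (just)
open import Data.Maybe.Properties using () renaming (≡-dec to ≡-decₘ)
open import Data.Maybe.Relation.Binary.Connected using (Connected; just)
open import Data.Nat using (ℕ; zero; suc; _+_; _*_; _∸_; _⊓_; _≤_; _<_; _<?_; _≤?_; z≤n; s≤s; _/_; _%_)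
open import Data.Nat.Properties renaming (_≟_ to _≟ℕ_)
open import Algebra.Properties.CommutativeSemigroup +-commutativeSemigroup using (xy∙z≈xz∙y)
open import Data.Nat.DivMod using (m≡m%n+[m/n]*n; m%n<n)
open import Data.Nat.Tactic.RingSolver using (solve-∀)
open import Data.Product using (Σ; ∃; _×_; _,_; proj₁; proj₂)
open import Data.Sum using (_⊎_; inj₁; inj₂; [_,_])
open import Function using (_∘_)
open import Function.Bundles using (Equivalence; mk↣)
open import Relation.Binary.Definitions using (DecidableEquality; Decidable)
open import Relation.Binary.PropositionalEquality using (_≡_; _≢_; refl; sym; trans; cong; cong₂; subst; subst₂; module ≡-Reasoning)
open import Relation.Nullary using (¬_; Dec; yes; no)
open import Relation.Nullary.Decidable using (T?; ¬?; ⌊_⌋; toWitness; fromWitness; map′; _→-dec_; _×-dec_)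
open import Relation.Unary using () renaming (Decidable to Decidable₁)

toℕ : V → ℕ
toℕ e = 0
toℕ ab = 1
toℕ ac = 2
toℕ bc = 3
toℕ abc = 4
toℕ acb = 5
toℕ e~ = 6
toℕ ab~ = 7
toℕ ac~ = 8
toℕ bc~ = 9
toℕ abc~ = 10
toℕ acb~ = 11

fromℕ : ℕ → V
fromℕ 0 = e
fromℕ 1 = ab
fromℕ 2 = ac
fromℕ 3 = bc
fromℕ 4 = abc
fromℕ 5 = acb
fromℕ 6 = e~
fromℕ 7 = ab~
fromℕ 8 = ac~
fromℕ 9 = bc~
fromℕ 10 = abc~
fromℕ _ = acb~

fromℕ-toℕ : ∀ a → fromℕ (toℕ a) ≡ a
fromℕ-toℕ e = refl
fromℕ-toℕ ab = refl
fromℕ-toℕ ac = refl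
fromℕ-toℕ bc = refl
fromℕ-toℕ abc = refl
fromℕ-toℕ acb = refl
fromℕ-toℕ e~ = refl
fromℕ-toℕ ab~ = refl
fromℕ-toℕ ac~ = refl
fromℕ-toℕ bc~ = refl
fromℕ-toℕ abc~ = refl
fromℕ-toℕ acb~ = refl

toℕ-injective : ∀ {a b} → toℕ a ≡ toℕ b → a ≡ b
toℕ-injective {a} {b} eq = trans (sym (fromℕ-toℕ a)) (trans (cong fromℕ eq) (fromℕ-toℕ b))

infix 4 _≟_ _≟ₗ_
_≟_ : DecidableEquality V
_≟_ = eq? (mk↣ toℕ-injective)

_≟ₗ_ : DecidableEquality (List V)
_≟ₗ_ = ≡-dec _≟_

vertices : List V
vertices = e ∷ ab ∷ ac ∷ bc ∷ abc ∷ acb ∷ e~ ∷ ab~ ∷ ac~ ∷ bc~ ∷ abc~ ∷ acb~ ∷ []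

∈-vertices : ∀ a → a ∈ vertices
∈-vertices e = here refl
∈-vertices ab = there (here refl)
∈-vertices ac = there (there (here refl))
∈-vertices bc = there (there (there (here refl)))
∈-vertices abc = there (there (there (there (here refl))))
∈-vertices acb = there (there (there (there (there (here refl)))))
∈-vertices e~ = there (there (there (there (there (there (here refl))))))
∈-vertices ab~ = there (there (there (there (there (there (there (here refl)))))))
∈-vertices ac~ = there (there (there (there (there (there (there (there (here refl))))))))
∈-vertices bc~ = there (there (there (there (there (there (there (there (there (here refl)))))))))
∈-vertices abc~ = there (there (there (there (there (there (there (there (there (there (here refl))))))))))
∈-vertices acb~ = there (there (there (there (there (there (there (there (there (there (there (here refl)))))))))))

∀? : {P : V → Set} → Decidable₁ P → Dec (∀ a → P a)
∀? P? = map′ (λ ps a → All.lookup ps (∈-vertices a)) (λ ps → All.tabulate (λ {a} _ → ps a)) (All.all? P? vertices)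

-- Every vertex has exactly two out-neighbours: its mate under a fixed-point-free
-- involution, and its successor on one of two directed 6-cycles.
mate : V → V
mate e = bc
mate bc = e
mate ab = abc
mate abc = ab
mate ac = acb
mate acb = ac
mate e~ = bc~
mate bc~ = e~
mate ab~ = abc~
mate abc~ = ab~
mate ac~ = acb~
mate acb~ = ac~

turn : V → V
turn e = ab~
turn ab~ = acb
turn acb = bc~
turn bc~ = abc
turn abc = ac~
turn ac~ = e
turn ab = e~
turn e~ = ac
turn ac = abc~
turn abc~ = bc
turn bc = acb~
turn acb~ = ab

arc-mate : ∀ a → Arc a (mate a)
arc-mate e = a2
arc-mate bc = a8
arc-mate ab = a4
arc-mate abc = a10
arc-mate ac = a6
arc-mate acb = a12
arc-mate e~ = a14
arc-mate bc~ = a20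
arc-mate ab~ = a16
arc-mate abc~ = a22
arc-mate ac~ = a18
arc-mate acb~ = a24

arc-turn : ∀ a → Arc a (turn a)
arc-turn e = a1
arc-turn ab~ = a15
arc-turn acb = a11
arc-turn bc~ = a19
arc-turn abc = a9
arc-turn ac~ = a17
arc-turn ab = a3
arc-turn e~ = a13
arc-turn ac = a5
arc-turn abc~ = a21
arc-turn bc = a7
arc-turn acb~ = a23

arc-target : ∀ {a b} → Arc a b → b ≡ mate a ⊎ b ≡ turn a
arc-target a1 = inj₂ refl
arc-target a2 = inj₁ refl
arc-target a3 = inj₂ refl
arc-target a4 = inj₁ refl
arc-target a5 = inj₂ refl
arc-target a6 = inj₁ refl
arc-target a7 = inj₂ refl
arc-target a8 = inj₁ refl
arc-target a9 = inj₂ refl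
arc-target a10 = inj₁ refl
arc-target a11 = inj₂ refl
arc-target a12 = inj₁ refl
arc-target a13 = inj₂ refl
arc-target a14 = inj₁ refl
arc-target a15 = inj₂ refl
arc-target a16 = inj₁ refl
arc-target a17 = inj₂ refl
arc-target a18 = inj₁ refl
arc-target a19 = inj₂ refl
arc-target a20 = inj₁ refl
arc-target a21 = inj₂ refl
arc-target a22 = inj₁ refl
arc-target a23 = inj₂ refl
arc-target a24 = inj₁ refl

arc? : Decidable Arc
arc? a b with b ≟ mate a | b ≟ turn a
... | yes refl | _ = yes (arc-mate a)
... | no _ | yes refl = yes (arc-turn a)
... | no ≢mate | no ≢turn = no (λ arc → [ ≢mate , ≢turn ] (arc-target arc))

colour : V → Bool
colour e = false
colour abc~ = false
colour acb = false
colour e~ = false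
colour abc = false
colour acb~ = false
colour _ = true

colour-arc : ∀ {a b} → Arc a b → colour b ≡ not (colour a)
colour-arc a1 = refl
colour-arc a2 = refl
colour-arc a3 = refl
colour-arc a4 = refl
colour-arc a5 = refl
colour-arc a6 = refl
colour-arc a7 = refl
colour-arc a8 = refl
colour-arc a9 = refl
colour-arc a10 = refl
colour-arc a11 = refl
colour-arc a12 = refl
colour-arc a13 = refl
colour-arc a14 = refl
colour-arc a15 = refl
colour-arc a16 = refl
colour-arc a17 = refl
colour-arc a18 = refl
colour-arc a19 = refl
colour-arc a20 = refl
colour-arc a21 = refl
colour-arc a22 = refl
colour-arc a23 = refl
colour-arc a24 = refl

colour-two-steps : ∀ {a b c} → Arc a b → Arc b c → colour c ≡ colour a
colour-two-steps x→y y→z = trans (colour-arc y→z) (trans (cong not (colour-arc x→y)) (not-involutive _))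

walk-between-colours-even : ∀ {a b} w → Linked Arc (a ∷ w ++ b ∷ []) → colour a ≢ colour b →
  ∃ λ q → length w ≡ 2 * q
walk-between-colours-even [] _ _ = 0 , refl
walk-between-colours-even (c ∷ []) (a→c ∷ c→b ∷ [-]) a≢b = ⊥-elim (a≢b (sym (colour-two-steps a→c c→b)))
walk-between-colours-even (c ∷ d ∷ w) (a→c ∷ c→d ∷ walk) a≢b
  with q , len ← walk-between-colours-even w walk (a≢b ∘ trans (sym (colour-two-steps a→c c→d)))
  = suc q , trans (cong (suc ∘ suc) len) (sym (*-suc 2 q))

-- Reading past the end yields the junk letter e; every use below is guarded by a length bound.
infixl 20 _‼_
_‼_ : List V → ℕ → V
[] ‼ _ = e
(x ∷ _) ‼ zero = x
(_ ∷ xs) ‼ suc k = xs ‼ k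

‼-++ˡ : ∀ xs ys {k} → k < length xs → (xs ++ ys) ‼ k ≡ xs ‼ k
‼-++ˡ (x ∷ xs) ys {zero} _ = refl
‼-++ˡ (x ∷ xs) ys {suc k} (s≤s k<) = ‼-++ˡ xs ys k<

‼-++ʳ : ∀ xs ys k → (xs ++ ys) ‼ (length xs + k) ≡ ys ‼ k
‼-++ʳ [] ys k = refl
‼-++ʳ (x ∷ xs) ys k = ‼-++ʳ xs ys k

‼-drop : ∀ m xs k → drop m xs ‼ k ≡ xs ‼ (m + k)
‼-drop zero xs k = refl
‼-drop (suc m) [] k = refl
‼-drop (suc m) (x ∷ xs) k = ‼-drop m xs k

‼-take : ∀ m xs {k} → k < m → take m xs ‼ k ≡ xs ‼ k
‼-take (suc m) [] _ = refl
‼-take (suc m) (x ∷ xs) {zero} _ = refl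
‼-take (suc m) (x ∷ xs) {suc k} (s≤s k<) = ‼-take m xs k<

‼-ext : ∀ xs ys → length xs ≡ length ys → (∀ k → k < length xs → xs ‼ k ≡ ys ‼ k) → xs ≡ ys
‼-ext [] [] _ _ = refl
‼-ext (x ∷ xs) (y ∷ ys) len pointwise =
  cong₂ _∷_ (pointwise 0 (s≤s z≤n)) (‼-ext xs ys (suc-injective len) (λ k k< → pointwise (suc k) (s≤s k<)))

All-‼ : ∀ {P : V → Set} {w i} → All P w → i < length w → P (w ‼ i)
All-‼ {i = zero} (px ∷ _) _ = px
All-‼ {i = suc i} (_ ∷ pxs) (s≤s i<) = All-‼ pxs i<

linked-‼ : ∀ {R : V → V → Set} {w i} → Linked R w → suc i < length w → R (w ‼ i) (w ‼ suc i)
linked-‼ [] ()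
linked-‼ [-] (s≤s ())
linked-‼ {i = zero} (r ∷ _) _ = r
linked-‼ {i = suc i} (_ ∷ rs) (s≤s i<) = linked-‼ rs i<

slice : ℕ → ℕ → List V → List V
slice q m w = take m (drop q w)

‼-slice : ∀ q m w {k} → k < m → slice q m w ‼ k ≡ w ‼ (q + k)
‼-slice q m w {k} k< = trans (‼-take m (drop q w) k<) (‼-drop q w k)

length-slice : ∀ q m w → length (slice q m w) ≡ m ⊓ (length w ∸ q)
length-slice q m w = trans (length-take m (drop q w)) (cong (m ⊓_) (length-drop q w))

record Square (w : List V) (i p : ℕ) : Set where
  constructor square
  field
    period>0 : 0 < p
    fits : i + (p + p) ≤ length w
    repeats : ∀ k → k < p → w ‼ (i + k) ≡ w ‼ (i + p + k)

NoSquare : List V → Set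
NoSquare w = ∀ i p → ¬ Square w i p

first-half : ∀ i {p k} → k < p → i + k < i + (p + p)
first-half i {p} k<p = +-monoʳ-< i (<-≤-trans k<p (m≤m+n p p))

second-half : ∀ i {p k} → k < p → i + p + k < i + (p + p)
second-half i {p} {k} k<p = subst (_< i + (p + p)) (sym (+-assoc i p k)) (+-monoʳ-< i (+-monoʳ-< p k<p))

square-of-factor : ∀ u y v → 0 < length y → Square (u ++ y ++ y ++ v) (length u) (length y)
square-of-factor u y v y≢[] = square y≢[] fits repeats
  where
  w : List V
  w = u ++ y ++ y ++ v
  fits : length u + (length y + length y) ≤ length w
  fits = begin
    length u + (length y + length y)             ≤⟨ +-monoʳ-≤ (length u) (+-monoʳ-≤ (length y) (m≤m+n _ _)) ⟩
    length u + (length y + (length y + length v)) ≡⟨ sym (cong (length u +_) (trans (length-++ y) (cong (length y +_) (length-++ y)))) ⟩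
    length u + length (y ++ y ++ v)              ≡⟨ sym (length-++ u) ⟩
    length w                                     ∎
    where open ≤-Reasoning
  repeats : ∀ k → k < length y → w ‼ (length u + k) ≡ w ‼ (length u + length y + k)
  repeats k k< = begin
    w ‼ (length u + k)                ≡⟨ ‼-++ʳ u (y ++ y ++ v) k ⟩
    (y ++ y ++ v) ‼ k                 ≡⟨ ‼-++ˡ y (y ++ v) k< ⟩
    y ‼ k                             ≡⟨ sym (‼-++ˡ y v k<) ⟩
    (y ++ v) ‼ k                      ≡⟨ sym (‼-++ʳ y (y ++ v) k) ⟩
    (y ++ y ++ v) ‼ (length y + k)    ≡⟨ sym (‼-++ʳ u (y ++ y ++ v) (length y + k)) ⟩
    w ‼ (length u + (length y + k))   ≡⟨ cong (w ‼_) (sym (+-assoc (length u) (length y) k)) ⟩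
    w ‼ (length u + length y + k)     ∎
    where open ≡-Reasoning

noSquare⇒squareFree : ∀ {w} → NoSquare w → SquareFree w
noSquare⇒squareFree no-square (u , a , x , v , refl) =
  no-square _ _ (square-of-factor u (a ∷ x) v (s≤s z≤n))

+-reassoc : ∀ q r p k → q + (r + p + k) ≡ q + r + p + k
+-reassoc = solve-∀

square-slice⁻ : ∀ q m w {r p} → Square (slice q m w) r p → Square w (q + r) p
square-slice⁻ q m w {r} {p} (square p>0 fits repeats) = square p>0 fits′ repeats′
  where
  fits-rest : r + (p + p) ≤ length w ∸ q
  fits-rest = ≤-trans fits (≤-trans (≤-reflexive (length-slice q m w)) (m⊓n≤n m _))
  q<len : q < length w
  q<len = m∸n≢0⇒n<m λ len∸q≡0 → <⇒≱ (≤-trans p>0 (≤-trans (m≤n+m p p) (m≤n+m (p + p) r))) (subst (r + (p + p) ≤_) len∸q≡0 fits-rest)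
  fits′ : q + r + (p + p) ≤ length w
  fits′ = subst (_≤ length w) (trans (+-comm (r + (p + p)) q) (sym (+-assoc q r (p + p))))
            (m≤o∸n⇒m+n≤o (r + (p + p)) (<⇒≤ q<len) fits-rest)
  in-slice : ∀ {j} → j < r + (p + p) → slice q m w ‼ j ≡ w ‼ (q + j)
  in-slice j< = ‼-slice q m w (<-≤-trans j< (≤-trans fits (≤-trans (≤-reflexive (length-slice q m w)) (m⊓n≤m m _))))
  repeats′ : ∀ k → k < p → w ‼ (q + r + k) ≡ w ‼ (q + r + p + k)
  repeats′ k k< = begin
    w ‼ (q + r + k)           ≡⟨ cong (w ‼_) (+-assoc q r k) ⟩
    w ‼ (q + (r + k))         ≡⟨ sym (in-slice (first-half r k<)) ⟩
    slice q m w ‼ (r + k)     ≡⟨ repeats k k< ⟩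
    slice q m w ‼ (r + p + k) ≡⟨ in-slice (second-half r k<) ⟩
    w ‼ (q + (r + p + k))     ≡⟨ cong (w ‼_) (+-reassoc q r p k) ⟩
    w ‼ (q + r + p + k)       ∎
    where open ≡-Reasoning

square-slice⁺ : ∀ q m w {r p} → Square w (q + r) p → r + (p + p) ≤ m → Square (slice q m w) r p
square-slice⁺ q m w {r} {p} (square p>0 fits repeats) fits-m = square p>0 fits′ repeats′
  where
  fits′ : r + (p + p) ≤ length (slice q m w)
  fits′ = subst (r + (p + p) ≤_) (sym (length-slice q m w))
            (⊓-glb fits-m (m+n≤o⇒m≤o∸n (r + (p + p)) (subst (_≤ length w) (trans (+-assoc q r (p + p)) (+-comm q _)) fits)))
  in-slice : ∀ {j} → j < r + (p + p) → slice q m w ‼ j ≡ w ‼ (q + j)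
  in-slice j< = ‼-slice q m w (<-≤-trans j< fits-m)
  repeats′ : ∀ k → k < p → slice q m w ‼ (r + k) ≡ slice q m w ‼ (r + p + k)
  repeats′ k k< = begin
    slice q m w ‼ (r + k)     ≡⟨ in-slice (first-half r k<) ⟩
    w ‼ (q + (r + k))         ≡⟨ cong (w ‼_) (sym (+-assoc q r k)) ⟩
    w ‼ (q + r + k)           ≡⟨ repeats k k< ⟩
    w ‼ (q + r + p + k)       ≡⟨ cong (w ‼_) (sym (+-reassoc q r p k)) ⟩
    w ‼ (q + (r + p + k))     ≡⟨ sym (in-slice (second-half r k<)) ⟩
    slice q m w ‼ (r + p + k) ∎
    where open ≡-Reasoning

noSquare-slice : ∀ q m {w} → NoSquare w → NoSquare (slice q m w)
noSquare-slice q m no-square r p sq = no-square (q + r) p (square-slice⁻ q m _ sq)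

agreeᵇ : ℕ → List V → List V → Bool
agreeᵇ zero _ _ = true
agreeᵇ (suc n) (x ∷ xs) (y ∷ ys) = ⌊ x ≟ y ⌋ ∧ agreeᵇ n xs ys
agreeᵇ (suc n) _ _ = false

agreeᵇ-sound : ∀ n xs ys → T (agreeᵇ n xs ys) → n ≤ length ys × (∀ k → k < n → xs ‼ k ≡ ys ‼ k)
agreeᵇ-sound zero xs ys _ = z≤n , λ _ ()
agreeᵇ-sound (suc n) (x ∷ xs) (y ∷ ys) ok
  with x≟y , rest ← Equivalence.to (T-∧ {⌊ x ≟ y ⌋}) ok
  with n≤ , pointwise ← agreeᵇ-sound n xs ys rest = s≤s n≤ , λ where
    zero _ → toWitness x≟y
    (suc k) (s≤s k<) → pointwise k k<

agreeᵇ-complete : ∀ n xs ys → n ≤ length xs → n ≤ length ys → (∀ k → k < n → xs ‼ k ≡ ys ‼ k) → T (agreeᵇ n xs ys)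
agreeᵇ-complete zero xs ys _ _ _ = _
agreeᵇ-complete (suc n) (x ∷ xs) (y ∷ ys) (s≤s n≤xs) (s≤s n≤ys) pointwise =
  Equivalence.from (T-∧ {⌊ x ≟ y ⌋}) (fromWitness (pointwise 0 (s≤s z≤n)) ,
    agreeᵇ-complete n xs ys n≤xs n≤ys (λ k k< → pointwise (suc k) (s≤s k<)))

square-prefix : ∀ s p → 0 < p → T (agreeᵇ p s (drop p s)) → Square s 0 p
square-prefix s p p>0 ok with p≤rest , pointwise ← agreeᵇ-sound p s (drop p s) ok =
  square p>0 fits λ k k< → trans (pointwise k k<) (‼-drop p s k)
  where
  p≤len∸p : p ≤ length s ∸ p
  p≤len∸p = subst (p ≤_) (length-drop p s) p≤rest
  fits : p + p ≤ length s
  fits = m≤o∸n⇒m+n≤o p (<⇒≤ (m∸n≢0⇒n<m λ len∸p≡0 → <⇒≱ p>0 (subst (p ≤_) len∸p≡0 p≤len∸p))) p≤len∸p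

prefix-square : ∀ {s p} → Square s 0 p → T (agreeᵇ p s (drop p s))
prefix-square {s} {p} (square _ fits repeats) =
  agreeᵇ-complete p s (drop p s) (≤-trans (m≤m+n p p) fits)
    (subst (p ≤_) (sym (length-drop p s)) (m+n≤o⇒m≤o∸n p fits))
    λ k k< → trans (repeats k k<) (sym (‼-drop p s k))

square-∷ : ∀ {x xs i p} → Square xs i p → Square (x ∷ xs) (suc i) p
square-∷ (square p>0 fits repeats) = square p>0 (s≤s fits) repeats

square-∷⁻ : ∀ {x xs i p} → Square (x ∷ xs) (suc i) p → Square xs i p
square-∷⁻ (square p>0 (s≤s fits) repeats) = square p>0 fits repeats

squaresᵇ : ℕ → List V → Bool
squaresᵇ b [] = false
squaresᵇ b s@(_ ∷ xs) = any (λ p → agreeᵇ (suc p) s (drop (suc p) s)) (upTo b) ∨ squaresᵇ b xs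

squaresᵇ-sound : ∀ b w → T (squaresᵇ b w) → ∃ λ i → ∃ λ p → Square w i p
squaresᵇ-sound b s@(_ ∷ xs) found with Equivalence.to (T-∨ {any _ (upTo b)}) found
... | inj₁ at-start with p , at-p ← Any.satisfied (Any.any⁻ _ (upTo b) at-start) = 0 , suc p , square-prefix s (suc p) (s≤s z≤n) at-p
... | inj₂ later with i , p , sq ← squaresᵇ-sound b xs later = suc i , p , square-∷ sq

squaresᵇ-complete : ∀ b {w i p} → Square w i p → p ≤ b → T (squaresᵇ b w)
squaresᵇ-complete b {[]} {i} {p} (square p>0 fits _) _ = <⇒≱ (<-≤-trans p>0 (≤-trans (m≤m+n p p) (m≤n+m (p + p) i))) fits
squaresᵇ-complete b {w@(_ ∷ xs)} {zero} {suc p} sq p≤b =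
  Equivalence.from (T-∨ {any _ (upTo b)}) (inj₁ (Any.any⁺ _ (Any.applyUpTo⁺ _ (prefix-square sq) p≤b)))
squaresᵇ-complete b {_ ∷ xs} {suc i} sq p≤b =
  Equivalence.from (T-∨ {any _ (upTo b)}) (inj₂ (squaresᵇ-complete b (square-∷⁻ sq) p≤b))

T-not⇒¬T : ∀ {x} → T (not x) → ¬ T x
T-not⇒¬T {false} _ ()

noSquare-by-computation : ∀ w → T (not (squaresᵇ (length w) w)) → NoSquare w
noSquare-by-computation w none i p sq = T-not⇒¬T none (squaresᵇ-complete (length w) sq p≤len)
  where
  p≤len : p ≤ length w
  p≤len = ≤-trans (m≤m+n p p) (≤-trans (m≤n+m (p + p) i) (Square.fits sq))

-- The morphism g

good : V → Bool
good e = false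
good ab~ = false
good _ = true

Good : V → Set
Good = T ∘ good

GoodWalk : List V → Set
GoodWalk w = Linked Arc w × All Good w

goodWalk? : Decidable₁ GoodWalk
goodWalk? w = linked? arc? w ×-dec All.all? (T? ∘ good) w

linked-drop : ∀ {R : V → V → Set} q {w} → Linked R w → Linked R (drop q w)
linked-drop zero walk = walk
linked-drop (suc q) [] = []
linked-drop (suc zero) [-] = []
linked-drop (suc (suc q)) [-] = []
linked-drop (suc q) (_ ∷ walk) = linked-drop q walk

linked-take : ∀ {R : V → V → Set} m {w} → Linked R w → Linked R (take m w)
linked-take zero _ = []
linked-take (suc m) [] = []
linked-take (suc zero) [-] = [-]
linked-take (suc (suc m)) [-] = [-]
linked-take (suc zero) (_ ∷ _) = [-]
linked-take (suc (suc m)) (r ∷ walk) = r ∷ linked-take (suc m) walk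

goodWalk-slice : ∀ q m {w} → GoodWalk w → GoodWalk (slice q m w)
goodWalk-slice q m (walk , goods) = linked-take m (linked-drop q walk) , All.take⁺ m (All.drop⁺ q goods)

-- The images of e and ab~ are placeholders: g is only ever applied to good letters.
g : V → List V
g bc = bc ∷ acb~ ∷ ab ∷ e~ ∷ bc~ ∷ abc ∷ ab ∷ e~ ∷ ac ∷ abc~ ∷ bc ∷ []
g abc~ = abc~ ∷ bc ∷ acb~ ∷ ac~ ∷ acb~ ∷ ab ∷ e~ ∷ ac ∷ acb ∷ ac ∷ abc~ ∷ []
g acb = acb ∷ ac ∷ abc~ ∷ bc ∷ acb~ ∷ ab ∷ abc ∷ ab ∷ e~ ∷ ac ∷ acb ∷ []
g ac~ = ac~ ∷ acb~ ∷ ab ∷ abc ∷ ab ∷ e~ ∷ bc~ ∷ abc ∷ ab ∷ abc ∷ ac~ ∷ []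
g bc~ = bc~ ∷ abc ∷ ac~ ∷ acb~ ∷ ab ∷ abc ∷ ab ∷ e~ ∷ ac ∷ acb ∷ bc~ ∷ []
g abc = abc ∷ ab ∷ e~ ∷ ac ∷ abc~ ∷ bc ∷ acb~ ∷ ab ∷ e~ ∷ bc~ ∷ abc ∷ []
g ac = ac ∷ abc~ ∷ bc ∷ acb~ ∷ ab ∷ e~ ∷ ac ∷ acb ∷ bc~ ∷ e~ ∷ ac ∷ []
g acb~ = acb~ ∷ ab ∷ abc ∷ ab ∷ e~ ∷ bc~ ∷ e~ ∷ ac ∷ abc~ ∷ bc ∷ acb~ ∷ []
g e~ = e~ ∷ ac ∷ acb ∷ ac ∷ abc~ ∷ bc ∷ acb~ ∷ ac~ ∷ acb~ ∷ ab ∷ e~ ∷ []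
g ab = ab ∷ e~ ∷ ac ∷ acb ∷ bc~ ∷ abc ∷ ab ∷ abc ∷ ac~ ∷ acb~ ∷ ab ∷ []
g e = e ∷ e ∷ e ∷ e ∷ e ∷ e ∷ e ∷ e ∷ e ∷ e ∷ e ∷ []
g ab~ = ab~ ∷ ab~ ∷ ab~ ∷ ab~ ∷ ab~ ∷ ab~ ∷ ab~ ∷ ab~ ∷ ab~ ∷ ab~ ∷ ab~ ∷ []

length-g : ∀ a → length (g a) ≡ 11
length-g = toWitness {a? = ∀? λ a → length (g a) ≟ℕ 11} _

g-first : ∀ a → g a ‼ 0 ≡ a
g-first = toWitness {a? = ∀? λ a → g a ‼ 0 ≟ a} _

g-last : ∀ a → last (g a) ≡ just a
g-last = toWitness {a? = ∀? λ a → ≡-decₘ _≟_ (last (g a)) (just a)} _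

g-goodWalk : ∀ a → Good a → GoodWalk (g a)
g-goodWalk = toWitness {a? = ∀? λ a → T? (good a) →-dec goodWalk? (g a)} _

G : List V → List V
G = concatMap g

length-G : ∀ w → length (G w) ≡ 11 * length w
length-G [] = refl
length-G (a ∷ w) = begin
  length (g a ++ G w)       ≡⟨ length-++ (g a) ⟩
  length (g a) + length (G w) ≡⟨ cong₂ _+_ (length-g a) (length-G w) ⟩
  11 + 11 * length w        ≡⟨ sym (*-suc 11 (length w)) ⟩
  11 * length (a ∷ w)       ∎
  where open ≡-Reasoning

head-G : ∀ a w → head (G (a ∷ w)) ≡ just a
head-G a w with g a | g-first a | length-g a
... | x ∷ _ | refl | _ = refl

G-goodWalk : ∀ {w} → GoodWalk w → GoodWalk (G w)
G-goodWalk {w} (walk , goods) = walk′ walk goods , goods′ goods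
  where
  walk′ : ∀ {w} → Linked Arc w → All Good w → Linked Arc (G w)
  walk′ [] [] = []
  walk′ {a ∷ []} [-] (good-a ∷ []) = subst (Linked Arc) (sym (++-identityʳ (g a))) (proj₁ (g-goodWalk a good-a))
  walk′ {a ∷ b ∷ w} (a→b ∷ walk) (good-a ∷ goods) =
    Linked.++⁺ (proj₁ (g-goodWalk a good-a)) (subst₂ (Connected Arc) (sym (g-last a)) (sym (head-G b w)) (just a→b)) (walk′ walk goods)
  goods′ : ∀ {w} → All Good w → All Good (G w)
  goods′ [] = []
  goods′ {a ∷ _} (good-a ∷ goods) = All.++⁺ (proj₂ (g-goodWalk a good-a)) (goods′ goods)

G-‼ : ∀ w {j r} → j < length w → r < 11 → G w ‼ (11 * j + r) ≡ g (w ‼ j) ‼ r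
G-‼ (a ∷ w) {zero} {r} _ r<11 = ‼-++ˡ (g a) (G w) (subst (r <_) (sym (length-g a)) r<11)
G-‼ (a ∷ w) {suc j} {r} (s≤s j<) r<11 = begin
  G (a ∷ w) ‼ (11 * suc j + r)      ≡⟨ cong (G (a ∷ w) ‼_) (trans (cong (_+ r) (*-suc 11 j)) (+-assoc 11 (11 * j) r)) ⟩
  (g a ++ G w) ‼ (11 + (11 * j + r)) ≡⟨ cong (λ n → (g a ++ G w) ‼ (n + (11 * j + r))) (sym (length-g a)) ⟩
  (g a ++ G w) ‼ (length (g a) + (11 * j + r)) ≡⟨ ‼-++ʳ (g a) (G w) _ ⟩
  G w ‼ (11 * j + r)                 ≡⟨ G-‼ w j< r<11 ⟩
  g (w ‼ j) ‼ r                      ∎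
  where open ≡-Reasoning

G-‼-first : ∀ w {j} → j < length w → G w ‼ (11 * j) ≡ w ‼ j
G-‼-first w {j} j< = trans (cong (G w ‼_) (sym (+-identityʳ (11 * j)))) (trans (G-‼ w j< (s≤s z≤n)) (g-first (w ‼ j)))

G-‼-pair : ∀ w {j t} → suc j < length w → t < 22 → G w ‼ (11 * j + t) ≡ (g (w ‼ j) ++ g (w ‼ suc j)) ‼ t
G-‼-pair (a ∷ b ∷ w) {zero} {t} _ t<22 = begin
  (g a ++ g b ++ G w) ‼ (0 + t) ≡⟨ cong (_‼ t) (sym (++-assoc (g a) (g b) (G w))) ⟩
  ((g a ++ g b) ++ G w) ‼ t     ≡⟨ ‼-++ˡ (g a ++ g b) (G w) (subst (t <_) (sym length-ab) t<22) ⟩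
  (g a ++ g b) ‼ t              ∎
  where
  open ≡-Reasoning
  length-ab : length (g a ++ g b) ≡ 22
  length-ab = trans (length-++ (g a)) (cong₂ _+_ (length-g a) (length-g b))
G-‼-pair (a ∷ w) {suc j} {t} (s≤s sj<) t<22 = begin
  (g a ++ G w) ‼ (11 * suc j + t)              ≡⟨ cong ((g a ++ G w) ‼_) (trans (cong (_+ t) (*-suc 11 j)) (+-assoc 11 (11 * j) t)) ⟩
  (g a ++ G w) ‼ (11 + (11 * j + t))           ≡⟨ cong (λ n → (g a ++ G w) ‼ (n + (11 * j + t))) (sym (length-g a)) ⟩
  (g a ++ G w) ‼ (length (g a) + (11 * j + t)) ≡⟨ ‼-++ʳ (g a) (G w) _ ⟩
  G w ‼ (11 * j + t)                           ≡⟨ G-‼-pair w sj< t<22 ⟩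
  (g (w ‼ j) ++ g (w ‼ suc j)) ‼ t             ∎
  where open ≡-Reasoning

drop-length-++ : ∀ (xs ys : List V) m → drop (length xs + m) (xs ++ ys) ≡ drop m ys
drop-length-++ [] ys m = refl
drop-length-++ (x ∷ xs) ys m = drop-length-++ xs ys m

take-length-++ : ∀ (xs ys : List V) m → take (length xs + m) (xs ++ ys) ≡ xs ++ take m ys
take-length-++ [] ys m = refl
take-length-++ (x ∷ xs) ys m = cong (x ∷_) (take-length-++ xs ys m)

G-drop : ∀ q w → G (drop q w) ≡ drop (11 * q) (G w)
G-drop zero w = refl
G-drop (suc q) [] = sym (drop-[] (11 * suc q))
G-drop (suc q) (a ∷ w) = begin
  G (drop q w)                                ≡⟨ G-drop q w ⟩
  drop (11 * q) (G w)                         ≡⟨ sym (drop-length-++ (g a) (G w) (11 * q)) ⟩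
  drop (length (g a) + 11 * q) (g a ++ G w)   ≡⟨ cong (λ n → drop (n + 11 * q) (g a ++ G w)) (length-g a) ⟩
  drop (11 + 11 * q) (g a ++ G w)             ≡⟨ cong (λ n → drop n (g a ++ G w)) (sym (*-suc 11 q)) ⟩
  drop (11 * suc q) (G (a ∷ w))               ∎
  where open ≡-Reasoning

G-take : ∀ m w → G (take m w) ≡ take (11 * m) (G w)
G-take zero w = refl
G-take (suc m) [] = sym (take-[] (11 * suc m))
G-take (suc m) (a ∷ w) = begin
  g a ++ G (take m w)                         ≡⟨ cong (g a ++_) (G-take m w) ⟩
  g a ++ take (11 * m) (G w)                  ≡⟨ sym (take-length-++ (g a) (G w) (11 * m)) ⟩
  take (length (g a) + 11 * m) (g a ++ G w)   ≡⟨ cong (λ n → take (n + 11 * m) (g a ++ G w)) (length-g a) ⟩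
  take (11 + 11 * m) (g a ++ G w)             ≡⟨ cong (λ n → take n (g a ++ G w)) (sym (*-suc 11 m)) ⟩
  take (11 * suc m) (G (a ∷ w))               ∎
  where open ≡-Reasoning

G-slice : ∀ q m w → G (slice q m w) ≡ slice (11 * q) (11 * m) (G w)
G-slice q m w = trans (G-take m (drop q w)) (cong (take (11 * m)) (G-drop q w))

-- g preserves square-freeness of good walks

divMod11 : ∀ x → ∃ λ q → ∃ λ r → r < 11 × x ≡ 11 * q + r
divMod11 x = x / 11 , x % 11 , m%n<n x 11 ,
  trans (m≡m%n+[m/n]*n x 11) (trans (+-comm (x % 11) _) (cong (_+ x % 11) (*-comm (x / 11) 11)))

roundUp11 : ∀ i → ∃ λ j → ∃ λ δ → δ ≤ 10 × 11 * j ≡ i + δ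
roundUp11 i with divMod11 i
... | q , zero , _ , refl = q , 0 , z≤n , sym (trans (+-identityʳ _) (+-identityʳ _))
... | q , suc r , s≤s r<10 , refl with δ , r+δ≡10 ← m≤n⇒∃[o]m+o≡n (<⇒≤ r<10) =
  suc q , δ , m+n≤o⇒n≤o r (≤-reflexive r+δ≡10) , (begin
    11 * suc q                ≡⟨ trans (*-suc 11 q) (+-comm 11 (11 * q)) ⟩
    11 * q + 11               ≡⟨ cong (λ n → 11 * q + suc n) (sym r+δ≡10) ⟩
    11 * q + suc (r + δ)      ≡⟨ sym (+-assoc (11 * q) (suc r) δ) ⟩
    11 * q + suc r + δ        ∎)
  where open ≡-Reasoning

goodWalks : ℕ → List (List V)
goodWalks zero = [] ∷ []
goodWalks (suc n) = concatMap (λ u → filter goodWalk? (map (_∷ u) vertices)) (goodWalks n)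

∈-goodWalks : ∀ {u} → GoodWalk u → u ∈ goodWalks (length u)
∈-goodWalks {[]} _ = here refl
∈-goodWalks {a ∷ u} good-walk@(walk , good-a ∷ goods) =
  ∈-concatMap⁺ (λ u → filter goodWalk? (map (_∷ u) vertices))
    (Any.map (λ { refl → ∈-filter⁺ goodWalk? (∈-map⁺ (_∷ u) (∈-vertices a)) good-walk }) (∈-goodWalks (tail walk , goods)))

no-short-squares-in-image : ∀ u → GoodWalk u → NoSquare u → length u ≤ 5 → ∀ {i p} → p ≤ 20 → ¬ Square (G u) i p
no-short-squares-in-image u good-walk no-square len≤5 {i} {p} p≤20 sq =
  [ (λ found → let i′ , p′ , sq′ = squaresᵇ-sound _ u found in no-square i′ p′ sq′)
  , (λ none → T-not⇒¬T {squaresᵇ 20 (G u)} none (squaresᵇ-complete 20 sq p≤20))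
  ] (Equivalence.to (T-∨ {squaresᵇ (length u) u} {not (squaresᵇ 20 (G u))})
                    (All.lookup (checked (s≤s len≤5)) (∈-goodWalks good-walk)))
  where
  checked : ∀ {n} → n < 6 → All (λ u → T (squaresᵇ (length u) u ∨ not (squaresᵇ 20 (G u)))) (goodWalks n)
  checked = toWitness {a? = allUpTo? (λ n → All.all? (λ u → T? _) (goodWalks n)) 6} _

-- A square of period at most 20 starting in block q ends before block q + 5.
short-period : ∀ {w} → GoodWalk w → NoSquare w → ∀ {i p} → p ≤ 20 → ¬ Square (G w) i p
short-period {w} good-walk no-square {i} {p} p≤20 sq with q , r , r<11 , refl ← divMod11 i =
  no-short-squares-in-image (slice q 5 w) (goodWalk-slice q 5 good-walk) (noSquare-slice q 5 no-square) len≤5 p≤20 sq-u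
  where
  len≤5 : length (slice q 5 w) ≤ 5
  len≤5 = ≤-trans (≤-reflexive (length-slice q 5 w)) (m⊓n≤m 5 _)
  fits : r + (p + p) ≤ 55
  fits = ≤-trans (+-mono-≤ (≤-pred r<11) (+-mono-≤ p≤20 p≤20)) (m≤m+n 50 5)
  sq-u : Square (G (slice q 5 w)) r p
  sq-u = subst (λ v → Square v r p) (sym (G-slice q 5 w)) (square-slice⁺ (11 * q) 55 (G w) sq fits)

-- The first letters of the blocks j + k and j + p + k face each other across the square.
aligned-period : ∀ {w} → NoSquare w → ∀ {i p} → ¬ Square (G w) i (11 * p)
aligned-period no-square {i} {zero} (square () _ _)
aligned-period {w} no-square {i} {p@(suc _)} (square _ fits repeats) with j , δ , δ≤10 , 11j≡i+δ ← roundUp11 i =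
  no-square j p (square (s≤s z≤n) fits′ repeats′)
  where
  N : ℕ
  N = length w
  fits′ : j + (p + p) ≤ N
  fits′ = ≤-pred (*-cancelˡ-< 11 _ _ (begin-strict
    11 * (j + (p + p))              ≡⟨ *-distribˡ-+ 11 j (p + p) ⟩
    11 * j + 11 * (p + p)           ≡⟨ cong₂ _+_ 11j≡i+δ (*-distribˡ-+ 11 p p) ⟩
    i + δ + (11 * p + 11 * p)       ≡⟨ xy∙z≈xz∙y i δ _ ⟩
    i + (11 * p + 11 * p) + δ       ≤⟨ +-mono-≤ (subst (_ ≤_) (length-G w) fits) δ≤10 ⟩
    11 * N + 10                     <⟨ +-monoʳ-< (11 * N) (n<1+n 10) ⟩
    11 * N + 11                     ≡⟨ trans (+-comm (11 * N) 11) (sym (*-suc 11 N)) ⟩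
    11 * suc N                      ∎))
    where open ≤-Reasoning
  repeats′ : ∀ k → k < p → w ‼ (j + k) ≡ w ‼ (j + p + k)
  repeats′ k k<p = begin
    w ‼ (j + k)                     ≡⟨ sym (G-‼-first w (<-≤-trans (first-half j k<p) fits′)) ⟩
    G w ‼ (11 * (j + k))            ≡⟨ cong (G w ‼_) first ⟩
    G w ‼ (i + (δ + 11 * k))        ≡⟨ repeats (δ + 11 * k) offset< ⟩
    G w ‼ (i + 11 * p + (δ + 11 * k)) ≡⟨ cong (G w ‼_) second ⟩
    G w ‼ (11 * (j + p + k))        ≡⟨ G-‼-first w (<-≤-trans (second-half j k<p) fits′) ⟩
    w ‼ (j + p + k)                 ∎
    where
    open ≡-Reasoning
    offset< : δ + 11 * k < 11 * p
    offset< = <-≤-trans (+-monoˡ-< (11 * k) (s≤s δ≤10)) (≤-trans (≤-reflexive (sym (*-suc 11 k))) (*-monoʳ-≤ 11 k<p))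
    first : 11 * (j + k) ≡ i + (δ + 11 * k)
    first = trans (*-distribˡ-+ 11 j k) (trans (cong (_+ 11 * k) 11j≡i+δ) (+-assoc i δ (11 * k)))
    second : i + 11 * p + (δ + 11 * k) ≡ 11 * (j + p + k)
    second = trans (regroup i δ p k) (trans (cong (_+ (11 * p + 11 * k)) (sym 11j≡i+δ)) (collect j p k))
      where
      regroup : ∀ i δ p k → i + 11 * p + (δ + 11 * k) ≡ i + δ + (11 * p + 11 * k)
      regroup = solve-∀
      collect : ∀ j p k → 11 * j + (11 * p + 11 * k) ≡ 11 * (j + p + k)
      collect = solve-∀

length-shifted-block : ∀ a b {o} → o < 10 → length (take 11 (drop (suc o) (g a ++ g b))) ≡ 11
length-shifted-block a b {o} o<10 = begin
  length (take 11 (drop (suc o) (g a ++ g b)))   ≡⟨ length-take 11 (drop (suc o) (g a ++ g b)) ⟩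
  11 ⊓ length (drop (suc o) (g a ++ g b))        ≡⟨ cong (11 ⊓_) (length-drop (suc o) (g a ++ g b)) ⟩
  11 ⊓ (length (g a ++ g b) ∸ suc o)             ≡⟨ cong (λ n → 11 ⊓ (n ∸ suc o)) (trans (length-++ (g a)) (cong₂ _+_ (length-g a) (length-g b))) ⟩
  11 ⊓ (22 ∸ suc o)                              ≡⟨ m≤n⇒m⊓n≡m (≤-trans (n≤1+n 11) (∸-monoʳ-≤ 22 o<10)) ⟩
  11                                             ∎
  where open ≡-Reasoning

synchronising : ∀ a b c → Good a → Good b → Arc a b → ∀ {o} → o < 10 → g c ≢ take 11 (drop (suc o) (g a ++ g b))
synchronising = toWitness {a? = ∀? λ a → ∀? λ b → ∀? λ c → T? (good a) →-dec T? (good b) →-dec arc? a b →-dec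
                                  allUpTo? (λ o → ¬? (g c ≟ₗ take 11 (drop (suc o) (g a ++ g b)))) 10} _

-- The block g c, c = w ‼ j, lies in the first half of the square, and its copy sits
-- at offset suc o inside the blocks j + p and j + p + 1.
unaligned-period : ∀ {w} → GoodWalk w → ∀ {i p o} → o < 10 → 20 < 11 * p + suc o → ¬ Square (G w) i (11 * p + suc o)
unaligned-period {w} (walk , goods) {i} {p} {o} o<10 20<P (square _ fits repeats) with j , δ , δ≤10 , 11j≡i+δ ← roundUp11 i =
  synchronising a b c (All-‼ goods (<-trans (n<1+n _) next<N)) (All-‼ goods next<N)
    (linked-‼ walk next<N) o<10 (‼-ext (g c) _ lengths pointwise)
  where
  P N : ℕ
  P = 11 * p + suc o
  N = length w
  c a b : V
  c = w ‼ j
  a = w ‼ (j + p)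
  b = w ‼ suc (j + p)
  fits-G : i + (P + P) ≤ 11 * N
  fits-G = subst (_ ≤_) (length-G w) fits
  after-copy : 11 * suc (j + p) + suc o ≡ i + P + (11 + δ)
  after-copy = trans (regroup j p o) (trans (cong (λ x → x + P + 11) 11j≡i+δ) (shuffle i δ P))
    where
    regroup : ∀ j p o → 11 * suc (j + p) + suc o ≡ 11 * j + (11 * p + suc o) + 11
    regroup = solve-∀
    shuffle : ∀ i δ P → i + δ + P + 11 ≡ i + P + (11 + δ)
    shuffle = solve-∀
  next<N : suc (j + p) < N
  next<N = *-cancelˡ-< 11 _ _ (begin-strict
    11 * suc (j + p)           <⟨ m<m+n _ (s≤s z≤n) ⟩
    11 * suc (j + p) + suc o   ≡⟨ after-copy ⟩
    i + P + (11 + δ)           ≤⟨ +-monoʳ-≤ (i + P) (≤-trans (+-monoʳ-≤ 11 δ≤10) 20<P) ⟩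
    i + P + P                  ≡⟨ +-assoc i P P ⟩
    i + (P + P)                ≤⟨ fits-G ⟩
    11 * N                     ∎)
    where open ≤-Reasoning
  lengths : length (g c) ≡ length (take 11 (drop (suc o) (g a ++ g b)))
  lengths = trans (length-g c) (sym (length-shifted-block a b o<10))
  pointwise : ∀ r → r < length (g c) → g c ‼ r ≡ take 11 (drop (suc o) (g a ++ g b)) ‼ r
  pointwise r r<len = begin
    g c ‼ r                                        ≡⟨ sym (G-‼ w (<-trans (s≤s (m≤m+n j p)) next<N) r<11) ⟩
    G w ‼ (11 * j + r)                             ≡⟨ cong (λ x → G w ‼ (x + r)) 11j≡i+δ ⟩
    G w ‼ (i + δ + r)                              ≡⟨ cong (G w ‼_) (+-assoc i δ r) ⟩
    G w ‼ (i + (δ + r))                            ≡⟨ repeats (δ + r) (≤-trans (s≤s (+-mono-≤ δ≤10 (≤-pred r<11))) 20<P) ⟩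
    G w ‼ (i + P + (δ + r))                        ≡⟨ cong (G w ‼_) copy ⟩
    G w ‼ (11 * (j + p) + (suc o + r))             ≡⟨ G-‼-pair w next<N o+r<22 ⟩
    (g a ++ g b) ‼ (suc o + r)                     ≡⟨ sym (‼-drop (suc o) (g a ++ g b) r) ⟩
    drop (suc o) (g a ++ g b) ‼ r                  ≡⟨ sym (‼-take 11 (drop (suc o) (g a ++ g b)) r<11) ⟩
    take 11 (drop (suc o) (g a ++ g b)) ‼ r        ∎
    where
    open ≡-Reasoning
    r<11 : r < 11
    r<11 = subst (r <_) (length-g c) r<len
    o+r<22 : suc o + r < 22
    o+r<22 = ≤-trans (≤-reflexive (sym (+-suc (suc o) r))) (≤-trans (+-mono-≤ o<10 r<11) (n≤1+n 21))
    copy : i + P + (δ + r) ≡ 11 * (j + p) + (suc o + r)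
    copy = trans (regroup i δ P r) (trans (cong (λ x → x + P + r) (sym 11j≡i+δ)) (collect j p o r))
      where
      regroup : ∀ i δ P r → i + P + (δ + r) ≡ i + δ + P + r
      regroup = solve-∀
      collect : ∀ j p o r → 11 * j + (11 * p + suc o) + r ≡ 11 * (j + p) + (suc o + r)
      collect = solve-∀

G-noSquare : ∀ {w} → GoodWalk w → NoSquare w → NoSquare (G w)
G-noSquare good-walk no-square i p sq with p ≤? 20 | divMod11 p
... | yes p≤20 | _ = short-period good-walk no-square p≤20 sq
... | no _ | p′ , zero , _ , refl = aligned-period no-square {i} {p′} (subst (Square _ i) (+-identityʳ (11 * p′)) sq)
... | no p≰20 | p′ , suc o , s≤s o<10 , refl = unaligned-period good-walk {i} {p′} o<10 (≰⇒> p≰20) sq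

W : ℕ → List V
W zero = abc~ ∷ []
W (suc j) = G (W j)

W-goodWalk : ∀ j → GoodWalk (W j)
W-goodWalk zero = [-] , _ ∷ []
W-goodWalk (suc j) = G-goodWalk (W-goodWalk j)

W-noSquare : ∀ j → NoSquare (W j)
W-noSquare zero i p (square p>0 fits _) = <⇒≱ (≤-trans (+-mono-≤ p>0 p>0) (m≤n+m (p + p) i)) fits
W-noSquare (suc j) = G-noSquare (W-goodWalk j) (W-noSquare j)

W-length : ∀ j → j < length (W j)
W-length zero = s≤s z≤n
W-length (suc j) = begin-strict
  suc j                  <⟨ +-mono-≤ (<-≤-trans (s≤s z≤n) (W-length j)) (W-length j) ⟩
  length (W j) + length (W j) ≡⟨ cong (length (W j) +_) (sym (+-identityʳ (length (W j)))) ⟩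
  2 * length (W j)        ≤⟨ *-monoˡ-≤ (length (W j)) (m≤m+n 2 9) ⟩
  11 * length (W j)       ≡⟨ sym (length-G (W j)) ⟩
  length (W (suc j))      ∎
  where open ≤-Reasoning

head-W : ∀ j → head (W j) ≡ just abc~
head-W zero = refl
head-W (suc j) with W j | head-W j
... | a ∷ w | refl = head-G a w

record Segment (before after : V) (ℓ : ℕ) : Set where
  field
    word : List V
    length-word : length word ≡ ℓ
    walk : Linked Arc (before ∷ word ++ after ∷ [])
    goods : All Good word
    no-square : NoSquare word

linked-between : ∀ {R : V → V → Set} {a b x w} → head w ≡ just x → R a x → Linked R w →
  Connected R (last w) (just b) → Linked R (a ∷ w ++ b ∷ [])
linked-between {w = _ ∷ _} refl a→x walk conn = a→x ∷ Linked.++⁺ walk conn [-]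

head-take : ∀ m (w : List V) → head (take (suc m) w) ≡ head w
head-take m [] = refl
head-take m (_ ∷ _) = refl

last-take : ∀ (w : List V) {x} → x < length w → last (take (suc x) w) ≡ just (w ‼ x)
last-take (a ∷ []) {zero} _ = refl
last-take (a ∷ []) {suc x} (s≤s ())
last-take (a ∷ b ∷ w) {zero} _ = refl
last-take (a ∷ b ∷ w) {suc x} (s≤s x<) = last-take (b ∷ w) x<

exit : V → ℕ
exit bc = 0
exit abc~ = 1
exit acb = 3
exit ac~ = 0
exit bc~ = 2
exit abc = 5
exit ac = 2
exit acb~ = 9
exit e~ = 5
exit ab = 8
exit e = 0
exit ab~ = 0

exit-arc : ∀ a → Good a → exit a < 11 × Arc (g a ‼ exit a) e
exit-arc = toWitness {a? = ∀? λ a → T? (good a) →-dec (exit a <? 11) ×-dec arc? (g a ‼ exit a) e} _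

prefix : ∀ j → ∃ λ ℓ → 11 * j < ℓ × ℓ ≤ 11 * suc j × Segment ab~ e ℓ
prefix j = suc x , s≤s (m≤m+n (11 * j) (exit a)) , x<11j+11 , record
  { word = P
  ; length-word = trans (length-take (suc x) W′) (m≤n⇒m⊓n≡m x<len)
  ; walk = linked-between (trans (head-take x W′) (head-W (suc j))) a16 (linked-take (suc x) (proj₁ (W-goodWalk (suc j))))
             (subst (λ l → Connected Arc l (just e)) (sym (trans (last-take W′ x<len) (cong just (G-‼ (W j) (W-length j) exit<11))))
               (just exit→e))
  ; goods = All.take⁺ (suc x) (proj₂ (W-goodWalk (suc j)))
  ; no-square = noSquare-slice 0 (suc x) (W-noSquare (suc j))
  }
  where
  W′ P : List V
  W′ = W (suc j)
  a : V
  a = W j ‼ j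
  exit<11 : exit a < 11
  exit<11 = proj₁ (exit-arc a (All-‼ (proj₂ (W-goodWalk j)) (W-length j)))
  exit→e : Arc (g a ‼ exit a) e
  exit→e = proj₂ (exit-arc a (All-‼ (proj₂ (W-goodWalk j)) (W-length j)))
  x : ℕ
  x = 11 * j + exit a
  P = take (suc x) W′
  x<11j+11 : x < 11 * suc j
  x<11j+11 = subst (x <_) (trans (+-comm (11 * j) 11) (sym (*-suc 11 j))) (+-monoʳ-< (11 * j) exit<11)
  x<len : x < length W′
  x<len = <-≤-trans x<11j+11 (subst (11 * suc j ≤_) (sym (length-G (W j))) (*-monoʳ-≤ 11 (W-length j)))

CheckedSegment : V → V → ℕ → List V → Set
CheckedSegment before after ℓ w =
  length w ≡ ℓ × Linked Arc (before ∷ w ++ after ∷ []) × All Good w × T (not (squaresᵇ (length w) w))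

checked-segment : ∀ {before after ℓ} w → CheckedSegment before after ℓ w → Segment before after ℓ
checked-segment w (len , walk , goods , none) = record
  { word = w ; length-word = len ; walk = walk ; goods = goods ; no-square = noSquare-by-computation w none }

checkedSegment? : ∀ before after ℓ w → Dec (CheckedSegment before after ℓ w)
checkedSegment? before after ℓ w = length w ≟ℕ ℓ ×-dec linked? arc? _ ×-dec All.all? (T? ∘ good) w ×-dec T? _

connectorWord : ℕ → List V
connectorWord 3 = bc ∷ acb~ ∷ ab ∷ e~ ∷ ac ∷ abc~ ∷ []
connectorWord 4 = bc ∷ acb~ ∷ ac~ ∷ acb~ ∷ ab ∷ e~ ∷ ac ∷ abc~ ∷ []
connectorWord 5 = bc ∷ acb~ ∷ ac~ ∷ acb~ ∷ ab ∷ abc ∷ ab ∷ e~ ∷ ac ∷ abc~ ∷ []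
connectorWord 6 = bc ∷ acb~ ∷ ac~ ∷ acb~ ∷ ab ∷ abc ∷ ab ∷ e~ ∷ bc~ ∷ e~ ∷ ac ∷ abc~ ∷ []
connectorWord 7 = bc ∷ acb~ ∷ ac~ ∷ acb~ ∷ ab ∷ abc ∷ ab ∷ e~ ∷ bc~ ∷ e~ ∷ ac ∷ acb ∷ ac ∷ abc~ ∷ []
connectorWord 8 = bc ∷ acb~ ∷ ac~ ∷ acb~ ∷ ab ∷ abc ∷ ab ∷ e~ ∷ bc~ ∷ e~ ∷ ac ∷ acb ∷ bc~ ∷ e~ ∷ ac ∷ abc~ ∷ []
connectorWord 9 = bc ∷ acb~ ∷ ac~ ∷ acb~ ∷ ab ∷ abc ∷ ab ∷ e~ ∷ bc~ ∷ e~ ∷ ac ∷ acb ∷ bc~ ∷ abc ∷ ab ∷ e~ ∷ ac ∷ abc~ ∷ []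
connectorWord 10 = bc ∷ acb~ ∷ ac~ ∷ acb~ ∷ ab ∷ abc ∷ ab ∷ e~ ∷ bc~ ∷ e~ ∷ ac ∷ acb ∷ ac ∷ abc~ ∷ bc ∷ acb~ ∷ ab ∷ e~ ∷ ac ∷ abc~ ∷ []
connectorWord 11 = bc ∷ acb~ ∷ ac~ ∷ acb~ ∷ ab ∷ abc ∷ ab ∷ e~ ∷ bc~ ∷ e~ ∷ ac ∷ acb ∷ ac ∷ abc~ ∷ bc ∷ acb~ ∷ ac~ ∷ acb~ ∷ ab ∷ e~ ∷ ac ∷ abc~ ∷ []
connectorWord 12 = bc ∷ acb~ ∷ ac~ ∷ acb~ ∷ ab ∷ abc ∷ ab ∷ e~ ∷ bc~ ∷ e~ ∷ ac ∷ acb ∷ ac ∷ abc~ ∷ bc ∷ acb~ ∷ ac~ ∷ acb~ ∷ ab ∷ abc ∷ ab ∷ e~ ∷ ac ∷ abc~ ∷ []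
connectorWord 13 = bc ∷ acb~ ∷ ac~ ∷ acb~ ∷ ab ∷ abc ∷ ab ∷ e~ ∷ bc~ ∷ e~ ∷ ac ∷ acb ∷ ac ∷ abc~ ∷ bc ∷ acb~ ∷ ac~ ∷ acb~ ∷ ab ∷ abc ∷ ab ∷ e~ ∷ bc~ ∷ e~ ∷ ac ∷ abc~ ∷ []
connectorWord _ = []

connector : ∀ h → 3 ≤ h → h ≤ 13 → Segment e ab~ (2 * h)
connector h 3≤h h≤13 = checked-segment (connectorWord h) (checked (s≤s h≤13) 3≤h)
  where
  checked : ∀ {h} → h < 14 → 3 ≤ h → CheckedSegment e ab~ (2 * h) (connectorWord h)
  checked = toWitness {a? = allUpTo? (λ h → 3 ≤? h →-dec checkedSegment? e ab~ (2 * h) (connectorWord h)) 14} _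

-- Circular square-freeness

Factor : List V → List V → Set
Factor F L = ∃ λ u → ∃ λ v → L ≡ u ++ F ++ v

factor-∷ : ∀ {a F L} → Factor F L → Factor F (a ∷ L)
factor-∷ {a} (u , v , refl) = a ∷ u , v , refl

factor-trans : ∀ {F L M} → Factor F L → Factor L M → Factor F M
factor-trans {F} (u , v , refl) (u′ , v′ , refl) = u′ ++ u , v ++ v′ , (begin
  u′ ++ (u ++ F ++ v) ++ v′     ≡⟨ cong (u′ ++_) (++-assoc u (F ++ v) v′) ⟩
  u′ ++ u ++ (F ++ v) ++ v′     ≡⟨ cong (λ l → u′ ++ u ++ l) (++-assoc F v v′) ⟩
  u′ ++ u ++ F ++ v ++ v′       ≡⟨ sym (++-assoc u′ u _) ⟩
  (u′ ++ u) ++ F ++ v ++ v′     ∎)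
  where open ≡-Reasoning

noSquare-factor : ∀ {y L} → 0 < length y → Factor (y ++ y) L → ¬ NoSquare L
noSquare-factor {y} y≢[] (u , v , refl) no-square =
  no-square _ _ (subst (λ l → Square l (length u) (length y)) (cong (u ++_) (sym (++-assoc y y v))) (square-of-factor u y v y≢[]))

rotation-split : ∀ b R k → ∃ λ A → ∃ λ B → rotate k (b ∷ R) ≡ A ++ b ∷ B × Factor A R × Factor B R
rotation-split b R zero = [] , R ++ [] , refl , ([] , R , refl) , ([] , [] , sym (trans (++-identityʳ _) (++-identityʳ R)))
rotation-split b R (suc k) = drop k R , take k R , refl ,
  (take k R , [] , sym (trans (cong (take k R ++_) (++-identityʳ _)) (take++drop≡id k R))) ,
  ([] , drop k R , sym (take++drop≡id k R))

prefix-avoiding : ∀ {b} (F v A B : List V) → All (_≢ b) F → A ++ b ∷ B ≡ F ++ v → ∃ λ v′ → A ≡ F ++ v′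
prefix-avoiding [] v A B _ _ = A , refl
prefix-avoiding (f ∷ F) v [] B (f≢b ∷ _) eq = ⊥-elim (f≢b (sym (proj₁ (∷-injective eq))))
prefix-avoiding (f ∷ F) v (a ∷ A) B (_ ∷ avoid) eq with refl , eq′ ← ∷-injective eq
  with v′ , refl ← prefix-avoiding F v A B avoid eq′ = v′ , refl

factor-avoiding : ∀ {b F} (A B : List V) → All (_≢ b) F → Factor F (A ++ b ∷ B) → Factor F A ⊎ Factor F B
factor-avoiding {F = F} A B avoid ([] , v , eq) with v′ , refl ← prefix-avoiding F v A B avoid eq = inj₁ ([] , v′ , refl)
factor-avoiding [] B _ (x ∷ u , v , eq) = inj₂ (u , v , proj₂ (∷-injective eq))
factor-avoiding (a ∷ A) B avoid (x ∷ u , v , eq) with factor-avoiding A B avoid (u , v , proj₂ (∷-injective eq))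
... | inj₁ in-A = inj₁ (factor-∷ in-A)
... | inj₂ in-B = inj₂ in-B

factor-of-rotation : ∀ b R k {F} → All (_≢ b) F → Factor F (rotate k (b ∷ R)) → Factor F R
factor-of-rotation b R k avoid in-rotation with A , B , split , A⊑R , B⊑R ← rotation-split b R k
  with factor-avoiding A B avoid (subst (Factor _) split in-rotation)
... | inj₁ in-A = factor-trans in-A A⊑R
... | inj₂ in-B = factor-trans in-B B⊑R

occurrences : V → List V → ℕ
occurrences b w = length (filter (_≟ b) w)

occurrences-++ : ∀ b xs ys → occurrences b (xs ++ ys) ≡ occurrences b xs + occurrences b ys
occurrences-++ b xs ys = trans (cong length (filter-++ (_≟ b) xs ys)) (length-++ (filter (_≟ b) xs))

occurrences-rotate : ∀ b k w → occurrences b (rotate k w) ≡ occurrences b w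
occurrences-rotate b k w = begin
  occurrences b (drop k w ++ take k w)                  ≡⟨ occurrences-++ b (drop k w) (take k w) ⟩
  occurrences b (drop k w) + occurrences b (take k w)   ≡⟨ +-comm (occurrences b (drop k w)) _ ⟩
  occurrences b (take k w) + occurrences b (drop k w)   ≡⟨ sym (occurrences-++ b (take k w) (drop k w)) ⟩
  occurrences b (take k w ++ drop k w)                  ≡⟨ cong (occurrences b) (take++drop≡id k w) ⟩
  occurrences b w                                       ∎
  where open ≡-Reasoning

occurrences-avoiding : ∀ {b w} → All (_≢ b) w → occurrences b w ≡ 0
occurrences-avoiding {b} avoid = cong length (filter-none (_≟ b) avoid)

square-avoids-unique : ∀ b u y v → occurrences b (u ++ y ++ y ++ v) ≡ 1 → All (_≢ b) (y ++ y)
square-avoids-unique b u y v once = All.++⁺ avoid avoid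
  where
  twice≤1 : ∀ m n o → m + (n + (n + o)) ≡ 1 → n ≡ 0
  twice≤1 m zero o _ = refl
  twice≤1 m (suc n) o eq =
    ⊥-elim (1+n≢0 (trans (sym (+-suc n (n + o))) (m+n≡0⇒n≡0 m (suc-injective (trans (sym (+-suc m _)) eq)))))
  none-in-y : occurrences b y ≡ 0
  none-in-y = twice≤1 (occurrences b u) (occurrences b y) (occurrences b v) (trans (sym (begin
    occurrences b (u ++ y ++ y ++ v)                                         ≡⟨ occurrences-++ b u _ ⟩
    occurrences b u + occurrences b (y ++ y ++ v)                            ≡⟨ cong (occurrences b u +_) (occurrences-++ b y _) ⟩
    occurrences b u + (occurrences b y + occurrences b (y ++ v))             ≡⟨ cong (λ n → occurrences b u + (occurrences b y + n)) (occurrences-++ b y v) ⟩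
    occurrences b u + (occurrences b y + (occurrences b y + occurrences b v)) ∎)) once)
    where open ≡-Reasoning
  avoid : All (_≢ b) y
  avoid = ¬Any⇒All¬ y λ b∈y → <⇒≢ (filter-some (_≟ b) b∈y) (sym none-in-y)

avoids-bad : ∀ {b w} → ¬ Good b → All Good w → All (_≢ b) w
avoids-bad bad = All.map λ { good-a refl → bad good-a }

circular-noSquare : ∀ {P T} → All Good P → All Good T → NoSquare P → NoSquare T → CircSquareFree (ab~ ∷ P ++ e ∷ T)
circular-noSquare {P} {T} good-P good-T no-square-P no-square-T k _ (u , a , x , v , rotation≡) =
  [ (λ in-P → noSquare-factor (s≤s z≤n) in-P no-square-P) , (λ in-T → noSquare-factor (s≤s z≤n) in-T no-square-T) ]
  (factor-avoiding P T (avoids e e-once) (factor-of-rotation ab~ (P ++ e ∷ T) k (avoids ab~ ab~-once) yy-in-rotation))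
  where
  y c : List V
  y = a ∷ x
  c = ab~ ∷ P ++ e ∷ T
  yy-in-rotation : Factor (y ++ y) (rotate k c)
  yy-in-rotation = u , v , trans rotation≡ (cong (u ++_) (sym (++-assoc y y v)))
  avoids : ∀ b → occurrences b c ≡ 1 → All (_≢ b) (y ++ y)
  avoids b once = square-avoids-unique b u y v (trans (cong (occurrences b) (sym rotation≡)) (trans (occurrences-rotate b k c) once))
  ab~-once : occurrences ab~ c ≡ 1
  ab~-once = cong suc (occurrences-avoiding (All.++⁺ (avoids-bad (λ ()) good-P) ((λ ()) ∷ avoids-bad (λ ()) good-T)))
  e-once : occurrences e c ≡ 1
  e-once = trans (occurrences-++ e P (e ∷ T))
    (cong₂ (λ m n → m + suc n) (occurrences-avoiding (avoids-bad (λ ()) good-P)) (occurrences-avoiding (avoids-bad (λ ()) good-T)))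

SquareFreeClosedWalk : ℕ → Set
SquareFreeClosedWalk n = Σ (List V) λ w → length w ≡ n × CircSquareFree w × Walkable w

linked-glue : ∀ {R : V → V → Set} xs {y zs} → Linked R (xs ++ y ∷ []) → Linked R (y ∷ zs) → Linked R (xs ++ y ∷ zs)
linked-glue [] _ walk = walk
linked-glue (x ∷ []) (r ∷ [-]) walk = r ∷ walk
linked-glue (x ∷ x′ ∷ xs) (r ∷ rs) walk = r ∷ linked-glue (x′ ∷ xs) rs walk

close : ∀ {ℓ₁ ℓ₂} → Segment ab~ e ℓ₁ → Segment e ab~ ℓ₂ → SquareFreeClosedWalk (suc (ℓ₁ + suc ℓ₂))
close {ℓ₁} {ℓ₂} P T =
  ab~ ∷ p ++ e ∷ t ,
  cong suc (trans (length-++ p) (cong₂ (λ m n → m + suc n) (Segment.length-word P) (Segment.length-word T))) ,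
  circular-noSquare (Segment.goods P) (Segment.goods T) (Segment.no-square P) (Segment.no-square T) ,
  subst (λ l → Linked Arc (ab~ ∷ l)) (sym (++-assoc p (e ∷ t) (ab~ ∷ []))) (linked-glue (ab~ ∷ p) (Segment.walk P) (Segment.walk T))
  where
  p t : List V
  p = Segment.word P
  t = Segment.word T

*-suc-+ : ∀ m n o → m * suc n + o ≡ m * n + (m + o)
*-suc-+ = solve-∀

connector-half-length : ∀ m j q → 11 * j < 2 * q → 2 * q ≤ 11 * suc j → 11 * j + 19 ≤ 2 * suc m → 2 * suc m ≤ 11 * j + 29 →
  ∃ λ h → 3 ≤ h × h ≤ 13 × suc (2 * q + suc (2 * h)) ≡ 2 * suc m
connector-half-length m j q 11j<2q 2q≤11j+11 lower upper =
  m ∸ q , *-cancelˡ-≤ 2 6≤2h , *-cancelˡ-≤ 2 2h≤26 , length≡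
  where
  2h≡ : 2 * (m ∸ q) ≡ 2 * suc m ∸ 2 * suc q
  2h≡ = *-distribˡ-∸ 2 (suc m) (suc q)
  room-below : 2 * suc q + 6 ≤ 2 * suc m
  room-below = begin
    2 * suc q + 6   ≡⟨ *-suc-+ 2 q 6 ⟩
    2 * q + 8       ≤⟨ +-monoˡ-≤ 8 2q≤11j+11 ⟩
    11 * suc j + 8  ≡⟨ *-suc-+ 11 j 8 ⟩
    11 * j + 19     ≤⟨ lower ⟩
    2 * suc m       ∎
    where open ≤-Reasoning
  room-above : 2 * suc m ≤ 2 * suc q + 26
  room-above = begin
    2 * suc m         ≤⟨ upper ⟩
    11 * j + 29       ≡⟨ +-suc (11 * j) 28 ⟩
    suc (11 * j) + 28 ≤⟨ +-monoˡ-≤ 28 11j<2q ⟩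
    2 * q + 28        ≡⟨ sym (*-suc-+ 2 q 26) ⟩
    2 * suc q + 26    ∎
    where open ≤-Reasoning
  6≤2h : 2 * 3 ≤ 2 * (m ∸ q)
  6≤2h = subst (6 ≤_) (sym 2h≡) (m+n≤o⇒m≤o∸n 6 (subst (_≤ 2 * suc m) (+-comm (2 * suc q) 6) room-below))
  2h≤26 : 2 * (m ∸ q) ≤ 2 * 13
  2h≤26 = subst (_≤ 26) (sym 2h≡) (m≤n+o⇒m∸n≤o (2 * suc m) (2 * suc q) room-above)
  length≡ : suc (2 * q + suc (2 * (m ∸ q))) ≡ 2 * suc m
  length≡ = begin
    suc (2 * q + suc (2 * (m ∸ q)))       ≡⟨ cong suc (+-suc (2 * q) _) ⟩
    2 + 2 * q + 2 * (m ∸ q)               ≡⟨ cong (_+ 2 * (m ∸ q)) (sym (*-suc 2 q)) ⟩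
    2 * suc q + 2 * (m ∸ q)               ≡⟨ cong (2 * suc q +_) 2h≡ ⟩
    2 * suc q + (2 * suc m ∸ 2 * suc q)   ≡⟨ m+[n∸m]≡n (≤-trans (m≤m+n (2 * suc q) 6) room-below) ⟩
    2 * suc m                             ∎
    where open ≡-Reasoning

bracket11 : ∀ n → 19 ≤ n → ∃ λ j → 11 * j + 19 ≤ n × n ≤ 11 * j + 29
bracket11 n 19≤n with j , r , r<11 , n∸19≡ ← divMod11 (n ∸ 19) = j , lower , upper
  where
  n≡ : n ≡ 11 * j + r + 19
  n≡ = trans (sym (m∸n+n≡m 19≤n)) (cong (_+ 19) n∸19≡)
  lower : 11 * j + 19 ≤ n
  lower = subst (11 * j + 19 ≤_) (sym n≡) (+-monoˡ-≤ 19 (m≤m+n (11 * j) r))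
  upper : n ≤ 11 * j + 29
  upper = subst (_≤ 11 * j + 29) (sym n≡) (≤-trans (+-monoˡ-≤ 19 (+-monoʳ-≤ (11 * j) (≤-pred r<11))) (≤-reflexive (+-assoc (11 * j) 10 19)))

large-case : ∀ m → 8 < m → SquareFreeClosedWalk (2 * suc m)
large-case m 8<m =
  let j , lower , upper = bracket11 (2 * suc m) (≤-trans (n≤1+n 19) (*-monoʳ-≤ 2 (s≤s 8<m)))
      ℓ , 11j<ℓ , ℓ≤11j+11 , P = prefix j
      q , word-even = walk-between-colours-even (Segment.word P) (Segment.walk P) (λ ())
      ℓ≡2q = trans (sym (Segment.length-word P)) word-even
      h , 3≤h , h≤13 , length≡ =
        connector-half-length m j q (subst (11 * j <_) ℓ≡2q 11j<ℓ) (subst (_≤ 11 * suc j) ℓ≡2q ℓ≤11j+11) lower upper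
  in subst SquareFreeClosedWalk (trans (cong (λ l → suc (l + suc (2 * h))) ℓ≡2q) length≡)
       (close P (connector h 3≤h h≤13))

walkable? : Decidable₁ Walkable
walkable? [] = yes tt
walkable? (w₀ ∷ ws) = linked? arc? (w₀ ∷ ws ++ w₀ ∷ [])

RotationsChecked : List V → Set
RotationsChecked w = ∀ {k} → k < length w → T (not (squaresᵇ (length (rotate k w)) (rotate k w)))

rotations-noSquare : ∀ w → RotationsChecked w → CircSquareFree w
rotations-noSquare w none k k< = noSquare⇒squareFree (noSquare-by-computation (rotate k w) (none k<))

smallWord : ℕ → List V
smallWord 0 = e ∷ bc ∷ []
smallWord 1 = e ∷ ab~ ∷ abc~ ∷ bc ∷ []
smallWord 2 = e ∷ ab~ ∷ acb ∷ bc~ ∷ abc ∷ ac~ ∷ []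
smallWord 3 = e ∷ ab~ ∷ acb ∷ bc~ ∷ abc ∷ ac~ ∷ e ∷ bc ∷ []
smallWord 4 = e ∷ ab~ ∷ acb ∷ bc~ ∷ abc ∷ ac~ ∷ e ∷ ab~ ∷ abc~ ∷ bc ∷ []
smallWord 5 = e ∷ ab~ ∷ acb ∷ bc~ ∷ abc ∷ ac~ ∷ e ∷ ab~ ∷ acb ∷ ac ∷ abc~ ∷ bc ∷ []
smallWord 6 = e ∷ ab~ ∷ acb ∷ bc~ ∷ abc ∷ ac~ ∷ e ∷ ab~ ∷ acb ∷ bc~ ∷ e~ ∷ ac ∷ abc~ ∷ bc ∷ []
smallWord 7 = e ∷ ab~ ∷ acb ∷ bc~ ∷ abc ∷ ac~ ∷ e ∷ ab~ ∷ acb ∷ bc~ ∷ abc ∷ ab ∷ e~ ∷ ac ∷ abc~ ∷ bc ∷ []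
smallWord 8 = e ∷ ab~ ∷ acb ∷ bc~ ∷ abc ∷ ac~ ∷ e ∷ ab~ ∷ acb ∷ bc~ ∷ abc ∷ ab ∷ e~ ∷ ac ∷ abc~ ∷ ab~ ∷ abc~ ∷ bc ∷ []
smallWord _ = []

small-case : ∀ m → m ≤ 8 → SquareFreeClosedWalk (2 * suc m)
small-case m m≤8 =
  let len , rotations , walkable = checked (s≤s m≤8)
  in smallWord m , len , rotations-noSquare (smallWord m) rotations , walkable
  where
  checked : ∀ {m} → m < 9 → length (smallWord m) ≡ 2 * suc m × RotationsChecked (smallWord m) × Walkable (smallWord m)
  checked = toWitness {a? = allUpTo? (λ m → length (smallWord m) ≟ℕ 2 * suc m
    ×-dec allUpTo? (λ k → T? (not (squaresᵇ (length (rotate k (smallWord m))) (rotate k (smallWord m))))) (length (smallWord m))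
    ×-dec walkable? (smallWord m)) 9} _

lemma12 : (m : ℕ) → Σ (List V) λ w →
    (length w ≡ 2 * suc m) × CircSquareFree w × Walkable w
lemma12 m with m ≤? 8
... | yes m≤8 = small-case m m≤8
... | no m≰8 = large-case m (≰⇒> m≰8)
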